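{- Let $k\ge\ell$ be nonnegative integers. (1) $$\binom{k}{\ell}_{\mathbb{Z},\mathbb{N}}=\prod_{b=2}^k b^{\beta(k,\ell,b)},\qquad \beta(k,\ell,b):=\sum_{i=1}^\infty\left(\left\lfloor\frac{k}{b^i}\right\rfloor-\left\lfloor\frac{\ell}{b^i}\right\rfloor-\left\lfloor\frac{k-\ell}{b^i}\right\rfloor\right).$$ (2) For every $b\ge2$, $$\beta(k,\ell,b)=\frac{1}{b-1}\big(d_b(\ell)+d_b(k-\ell)-d_b(k)\big),$$ where $d_b(j)$ is the sum of the base-$b$ digits of $j$.
   Context: For integers $b\ge0$ and $a\in\mathbb{Z}$ let $\operatorname{ord}_b(a):=\sup\{k\in\mathbb{N}: a\mathbb{Z}\subseteq b^k\mathbb{Z}\}$ (convention $0^0=1$); for $b\ge2$ this is the largest $k$ with $b^k\mid a$; $\operatorname{ord}_1\equiv+\infty$; $\operatorname{ord}_0(a)=0$ for $a\ne0$, $\operatorname{ord}_0(0)=+\infty$. For nonempty $S\subseteq\mathbb{Z}$, a $b$-ordering of $S$ is an infinite sequence $(a_i)_{i\ge0}$ in $S$ such that for every $i\ge1$, $\sum_{j<i}\operatorname{ord}_b(a_i-a_j)=\min_{a'\in S}\sum_{j<i}\operatorname{ord}_b(a'-a_j)$. The quantity $\alpha_k(S,b):=\sum_{j<k}\operatorname{ord}_b(a_k-a_j)$ (with $\alpha_0=0$) does not depend on the choice of $b$-ordering. For $\mathcal{T}\subseteq\mathbb{N}$, $k!_{S,\mathcal{T}}:=\prod_{b\in\mathcal{T}}b^{\alpha_k(S,b)}$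 (conventions $b^{+\infty}=0$ for $b\ge2$ and $b=0$, $1^{+\infty}=1$, $b^0=1$), and $\binom{k}{\ell}_{S,\mathcal{T}}:=\dfrac{k!_{S,\mathcal{T}}}{\ell!_{S,\mathcal{T}}(k-\ell)!_{S,\mathcal{T}}}$. -}

module Defs where

open import Data.Nat as ℕ using (ℕ; zero; suc; _+_; _*_; _∸_; _^_; _/_; _%_; _≤_)
open import Data.Nat.Properties using (m^n≢0)
open import Data.Nat.Divisibility using (_∣?_)
open import Data.Integer as ℤ using (ℤ; +_; -[1+_]; ∣_∣)
open import Data.Rational as ℚ using (ℚ)
open import Data.Product using (Σ; _×_)
open import Relation.Nullary using (yes; no)
open import Relation.Binary.PropositionalEquality using (_≡_)

data ℕ∞ : Set where
  fin : ℕ → ℕ∞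
  ∞   : ℕ∞

infixl 6 _+∞_
_+∞_ : ℕ∞ → ℕ∞ → ℕ∞
fin m +∞ fin n = fin (m + n)
fin _ +∞ ∞     = ∞
∞     +∞ _     = ∞

infix 4 _≤∞_
data _≤∞_ : ℕ∞ → ℕ∞ → Set where
  fin≤fin : ∀ {m n} → m ≤ n → fin m ≤∞ fin n
  _≤∞∞    : ∀ x → x ≤∞ ∞

-- largest k with b^k ∣ n  (intended for b ≥ 2, n ≥ 1); fuel n suffices
-- since such k ≤ log₂ n < n.
valAux : (b : ℕ) → .{{_ : ℕ.NonZero b}} → (fuel n : ℕ) → ℕ
valAux b zero      n = 0
valAux b (suc f)   n with b ∣? n
... | yes _ = suc (valAux b f (n / b))
... | no  _ = 0

-- ord_b(a), following the conventions of the paper: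
--   ord_0(0) = ∞, ord_0(a) = 0 for a ≠ 0; ord_1 ≡ ∞;
--   for b ≥ 2: ord_b(0) = ∞, otherwise the largest k with b^k ∣ a.
ord : ℕ → ℤ → ℕ∞
ord zero          (+ zero) = ∞
ord zero          _        = fin 0
ord (suc zero)    _        = ∞
ord (suc (suc c)) (+ zero) = ∞
ord (suc (suc c)) a        = fin (valAux (suc (suc c)) ∣ a ∣ ∣ a ∣)

sumOrd : ℕ → (ℕ → ℤ) → ℕ → ℤ → ℕ∞
sumOrd b s zero    x = fin 0
sumOrd b s (suc i) x = sumOrd b s i x +∞ ord b (x ℤ.- s i)

IsBOrdering : ℕ → (ℕ → ℤ) → Set
IsBOrdering b s = ∀ i → 1 ≤ i → ∀ (a′ : ℤ) → sumOrd b s i (s i) ≤∞ sumOrd b s i a′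

α : ℕ → (ℕ → ℤ) → ℕ → ℕ∞
α b s k = sumOrd b s k (s k)

pow∞ : ℕ → ℕ∞ → ℕ
pow∞ b             (fin n) = b ^ n
pow∞ (suc zero)    ∞       = 1
pow∞ _             ∞       = 0

prodBelow : (ℕ → ℕ) → ℕ → ℕ
prodBelow f zero    = 1
prodBelow f (suc B) = prodBelow f B * f B

-- "k!_{ℤ,ℕ} = N", where ords b is a b-ordering of ℤ for each b ∈ ℕ:
-- the infinite product ∏_{b ∈ ℕ} b^{α_k(ℤ,b)} has almost all factors 1
-- and its value is N.
IsGenFactorial : (ords : ℕ → ℕ → ℤ) → ℕ → ℕ → Set
IsGenFactorial ords k N =
  Σ ℕ λ B → (∀ b → B ≤ b → pow∞ b (α b (ords b) k) ≡ 1)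
          × (N ≡ prodBelow (λ b → pow∞ b (α b (ords b) k)) B)

sumℤ1 : (ℕ → ℤ) → ℕ → ℤ
sumℤ1 f zero    = + 0
sumℤ1 f (suc n) = sumℤ1 f n ℤ.+ f (suc n)

-- β(k,ℓ,b) = Σ_{i≥1} (⌊k/b^i⌋ - ⌊ℓ/b^i⌋ - ⌊(k-ℓ)/b^i⌋), for b ≥ 2.
-- For b ≥ 2 and i ≥ k we have b^i > k ≥ ℓ, k-ℓ, so all terms with i > k
-- vanish and the series equals its partial sum up to i = k.
-- (Value for b < 2 is irrelevant and set to 0.)
β : ℕ → ℕ → ℕ → ℤ
β k ℓ zero          = + 0
β k ℓ (suc zero)    = + 0
β k ℓ (suc (suc c)) = sumℤ1 term k
  where
  b = suc (suc c)
  term : ℕ → ℤ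
  term i = ((+ (k / (b ^ i)) {{m^n≢0 b i}}) ℤ.- (+ (ℓ / (b ^ i)) {{m^n≢0 b i}}))
           ℤ.- (+ ((k ∸ ℓ) / (b ^ i)) {{m^n≢0 b i}})

digitSumAux : (b : ℕ) → .{{_ : ℕ.NonZero b}} → (fuel n : ℕ) → ℕ
digitSumAux b zero    n = 0
digitSumAux b (suc f) n = n % b + digitSumAux b f (n / b)

digitSum : ℕ → ℕ → ℕ
digitSum zero          n = 0
digitSum (suc zero)    n = 0
digitSum (suc (suc c)) n = digitSumAux (suc (suc c)) n n

zpow : ℕ → ℤ → ℚ
zpow zero          e          = ℚ.1ℚ
zpow (suc zero)    e          = ℚ.1ℚ
zpow (suc (suc c)) (+ n)      = + (suc (suc c) ^ n) ℚ./ 1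
zpow (suc (suc c)) -[1+ n ]   = ((+ 1) ℚ./ (suc (suc c) ^ suc n)) {{m^n≢0 (suc (suc c)) (suc n)}}

prodℚ2 : (ℕ → ℚ) → ℕ → ℚ
prodℚ2 f zero          = ℚ.1ℚ
prodℚ2 f (suc zero)    = ℚ.1ℚ
prodℚ2 f (suc (suc k)) = prodℚ2 f (suc k) ℚ.* f (suc (suc k))

{-# OPTIONS --safe #-}
-- For b ≥ 2 every b-ordering s of ℤ is equidistributed: each residue class modulo b^m contains
-- ⌊n / b^m⌋ or ⌈n / b^m⌉ of s₀, …, sₙ₋₁. Since Σ_{j<n} ord_b(a − s_j) = Σ_{m≥1} #{j < n : b^m ∣ a − s_j},
-- a point lying in a least crowded class for every m attains Σ_{m≥1} ⌊n / b^m⌋, and equidistribution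
-- makes this the minimum. Hence α_n(ℤ, b) = Σ_{m≥1} ⌊n / b^m⌋, and sₙ lies in least crowded classes,
-- which keeps s₀, …, sₙ equidistributed. The bases 0 and 1 contribute factors 1, so the exponent of b in
-- the binomial is β(k, ℓ, b), which is nonnegative because ⌊x / N⌋ + ⌊y / N⌋ ≤ ⌊(x + y) / N⌋; Legendre's
-- identity (b − 1) Σ_{m≥1} ⌊n / b^m⌋ = n − d_b(n) turns β into the digit-sum formula.
module Submission where

open import Data.Nat using (ℕ; NonZero)
open import Data.Integer using (ℤ)
open import Defs

module FiniteSums where

  open import Data.Nat
  open import Data.Nat.Properties
  open import Data.Product using (Σ; _×_; _,_)
  open import Data.Sum using (_⊎_; inj₁; inj₂)
  open import Data.Empty using (⊥-elim)
  open import Relation.Nullary using (Dec; yes; no; ¬_)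
  open import Relation.Binary.PropositionalEquality
  open import Algebra.Properties.CommutativeSemigroup +-commutativeSemigroup using () renaming (interchange to +-interchange)

  χ : ∀ {p} {P : Set p} → Dec P → ℕ
  χ (yes _) = 1
  χ (no _)  = 0

  χ-yes : ∀ {p} {P : Set p} (d : Dec P) → P → χ d ≡ 1
  χ-yes (yes _) _ = refl
  χ-yes (no ¬p) p = ⊥-elim (¬p p)

  χ-no : ∀ {p} {P : Set p} (d : Dec P) → ¬ P → χ d ≡ 0
  χ-no (yes p) ¬p = ⊥-elim (¬p p)
  χ-no (no _)  _  = refl

  χ≢0⇒ : ∀ {p} {P : Set p} (d : Dec P) → χ d ≢ 0 → P
  χ≢0⇒ (yes p) _  = p
  χ≢0⇒ (no _)  ne = ⊥-elim (ne refl)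

  χ-cong : ∀ {p q} {P : Set p} {Q : Set q} (dp : Dec P) (dq : Dec Q) →
           (P → Q) → (Q → P) → χ dp ≡ χ dq
  χ-cong (yes _) (yes _) _ _ = refl
  χ-cong (no _)  (no _)  _ _ = refl
  χ-cong (yes p) (no ¬q) f _ = ⊥-elim (¬q (f p))
  χ-cong (no ¬p) (yes q) _ g = ⊥-elim (¬p (g q))

  Σ< : ℕ → (ℕ → ℕ) → ℕ
  Σ< zero    f = 0
  Σ< (suc n) f = Σ< n f + f n

  Σ₁ : ℕ → (ℕ → ℕ) → ℕ
  Σ₁ L f = Σ< L (λ m → f (suc m))

  Σ<-cong : ∀ n {f g : ℕ → ℕ} → (∀ i → i < n → f i ≡ g i) → Σ< n f ≡ Σ< n g
  Σ<-cong zero    h = refl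
  Σ<-cong (suc n) h = cong₂ _+_ (Σ<-cong n (λ i i<n → h i (m<n⇒m<1+n i<n))) (h n ≤-refl)

  Σ<-mono : ∀ n {f g : ℕ → ℕ} → (∀ i → i < n → f i ≤ g i) → Σ< n f ≤ Σ< n g
  Σ<-mono zero    h = z≤n
  Σ<-mono (suc n) h = +-mono-≤ (Σ<-mono n (λ i i<n → h i (m<n⇒m<1+n i<n))) (h n ≤-refl)

  Σ<-const : ∀ n k → Σ< n (λ _ → k) ≡ n * k
  Σ<-const zero    k = refl
  Σ<-const (suc n) k = trans (cong (_+ k) (Σ<-const n k)) (+-comm (n * k) k)

  Σ<-zero : ∀ n → Σ< n (λ _ → 0) ≡ 0
  Σ<-zero n = trans (Σ<-const n 0) (*-zeroʳ n)

  Σ<-+ : ∀ n (f g : ℕ → ℕ) → Σ< n (λ i → f i + g i) ≡ Σ< n f + Σ< n g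
  Σ<-+ zero    f g = refl
  Σ<-+ (suc n) f g = trans (cong (_+ (f n + g n)) (Σ<-+ n f g)) (+-interchange (Σ< n f) (Σ< n g) (f n) (g n))

  Σ<-*ˡ : ∀ n k (f : ℕ → ℕ) → Σ< n (λ i → k * f i) ≡ k * Σ< n f
  Σ<-*ˡ zero    k f = sym (*-zeroʳ k)
  Σ<-*ˡ (suc n) k f = trans (cong (_+ k * f n) (Σ<-*ˡ n k f)) (sym (*-distribˡ-+ k (Σ< n f) (f n)))

  Σ<-swap : ∀ n m (h : ℕ → ℕ → ℕ) →
            Σ< n (λ i → Σ< m (h i)) ≡ Σ< m (λ j → Σ< n (λ i → h i j))
  Σ<-swap zero    m h = sym (Σ<-zero m)
  Σ<-swap (suc n) m h = trans (cong (_+ Σ< m (h n)) (Σ<-swap n m h))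
                              (sym (Σ<-+ m (λ j → Σ< n (λ i → h i j)) (h n)))

  Σ<-shift : ∀ n (f : ℕ → ℕ) → Σ< (suc n) f ≡ f 0 + Σ< n (λ i → f (suc i))
  Σ<-shift zero    f = +-comm 0 (f 0)
  Σ<-shift (suc n) f = trans (cong (_+ f (suc n)) (Σ<-shift n f)) (+-assoc (f 0) _ _)

  Σ<-term : ∀ n (f : ℕ → ℕ) {j} → j < n → f j ≤ Σ< n f
  Σ<-term (suc n) f {j} j<1+n with j ≟ n
  ... | yes refl = m≤n+m (f n) (Σ< n f)
  ... | no j≢n   = ≤-trans (Σ<-term n f (≤∧≢⇒< (≤-pred j<1+n) j≢n)) (m≤m+n (Σ< n f) (f n))

  Σ<-point : ∀ n {e} → e < n → Σ< n (λ d → χ (d ≟ e)) ≡ 1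
  Σ<-point (suc n) {e} e<1+n with e ≟ n
  ... | yes refl = trans (cong (_+ χ (n ≟ n)) (Σ<-away n (λ i i<n → <⇒≢ i<n))) (χ-yes (n ≟ n) refl)
    where
    Σ<-away : ∀ m → (∀ i → i < m → i ≢ n) → Σ< m (λ d → χ (d ≟ n)) ≡ 0
    Σ<-away zero    _ = refl
    Σ<-away (suc m) h = cong₂ _+_ (Σ<-away m (λ i i<m → h i (m<n⇒m<1+n i<m))) (χ-no (m ≟ n) (h m ≤-refl))
  ... | no e≢n = cong₂ _+_ (Σ<-point n (≤∧≢⇒< (≤-pred e<1+n) e≢n)) (χ-no (n ≟ e) (≢-sym e≢n))

  Σ<≡0⇒ : ∀ n (f : ℕ → ℕ) → Σ< n f ≡ 0 → ∀ {i} → i < n → f i ≡ 0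
  Σ<≡0⇒ n f eq i<n = n≤0⇒n≡0 (subst (_ ≤_) eq (Σ<-term n f i<n))

  Σ<≢0⇒ : ∀ n (f : ℕ → ℕ) → Σ< n f ≢ 0 → Σ ℕ λ i → i < n × f i ≢ 0
  Σ<≢0⇒ zero    f ne = ⊥-elim (ne refl)
  Σ<≢0⇒ (suc n) f ne with f n ≟ 0
  ... | no fn≢0 = n , ≤-refl , fn≢0
  ... | yes fn≡0 with Σ<≢0⇒ n f (λ eq → ne (trans (cong₂ _+_ eq fn≡0) refl))
  ...   | i , i<n , fi≢0 = i , m<n⇒m<1+n i<n , fi≢0

  Σ<-pigeonhole : ∀ n (f : ℕ → ℕ) B → (Σ ℕ λ i → i < n × f i ≤ B) ⊎ (n * suc B ≤ Σ< n f)
  Σ<-pigeonhole zero    f B = inj₂ z≤n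
  Σ<-pigeonhole (suc n) f B with f n ≤? B
  ... | yes fn≤B = inj₁ (n , ≤-refl , fn≤B)
  ... | no fn≰B with Σ<-pigeonhole n f B
  ...   | inj₁ (i , i<n , fi≤B) = inj₁ (i , m<n⇒m<1+n i<n , fi≤B)
  ...   | inj₂ big = inj₂ (subst (_≤ Σ< n f + f n) (+-comm (n * suc B) (suc B)) (+-mono-≤ big (≰⇒> fn≰B)))

  Σ<-mono-≡ : ∀ n {f g : ℕ → ℕ} → (∀ i → i < n → f i ≤ g i) → Σ< n g ≤ Σ< n f →
              ∀ i → i < n → f i ≡ g i
  Σ<-mono-≡ (suc n) {f} {g} f≤g Σg≤Σf i i<1+n with i ≟ n
  ... | yes refl = fn≡gn
    where
    fn≡gn : f n ≡ g n
    fn≡gn = ≤-antisym (f≤g n ≤-refl)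
      (+-cancelˡ-≤ (Σ< n f) (g n) (f n)
        (≤-trans (+-monoˡ-≤ (g n) (Σ<-mono n (λ j j<n → f≤g j (m<n⇒m<1+n j<n)))) Σg≤Σf))
  ... | no i≢n = Σ<-mono-≡ n (λ j j<n → f≤g j (m<n⇒m<1+n j<n))
                   (+-cancelʳ-≤ (f n) (Σ< n g) (Σ< n f) (≤-trans (+-monoʳ-≤ (Σ< n g) (f≤g n ≤-refl)) Σg≤Σf))
                   i (≤∧≢⇒< (≤-pred i<1+n) i≢n)

  Σ<-two-deficits : ∀ n (f : ℕ → ℕ) B {d₀ d₁} → d₀ < n → d₁ < n → d₀ ≢ d₁ →
                    (∀ d → d < n → f d ≤ B) → f d₀ < B → f d₁ < B → 2 + Σ< n f ≤ n * B
  Σ<-two-deficits n f B {d₀} {d₁} d₀<n d₁<n d₀≢d₁ f≤B fd₀<B fd₁<B = begin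
    2 + Σ< n f                               ≡⟨ +-comm 2 (Σ< n f) ⟩
    Σ< n f + 2                               ≡⟨ +-assoc (Σ< n f) 1 1 ⟨
    Σ< n f + 1 + 1                           ≡⟨ cong₂ (λ x y → Σ< n f + x + y) (Σ<-point n d₀<n) (Σ<-point n d₁<n) ⟨
    Σ< n f + Σ< n (δ d₀) + Σ< n (δ d₁)       ≡⟨ cong (_+ Σ< n (δ d₁)) (Σ<-+ n f (δ d₀)) ⟨
    Σ< n (λ d → f d + δ d₀ d) + Σ< n (δ d₁)  ≡⟨ Σ<-+ n (λ d → f d + δ d₀ d) (δ d₁) ⟨
    Σ< n (λ d → f d + δ d₀ d + δ d₁ d)       ≤⟨ Σ<-mono n raised≤B ⟩
    Σ< n (λ _ → B)                           ≡⟨ Σ<-const n B ⟩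
    n * B                                    ∎
    where
    open ≤-Reasoning
    δ : ℕ → ℕ → ℕ
    δ e d = χ (d ≟ e)
    raised≤B : ∀ d → d < n → f d + δ d₀ d + δ d₁ d ≤ B
    raised≤B d d<n with d ≟ d₀ | d ≟ d₁
    ... | yes refl | yes refl = ⊥-elim (d₀≢d₁ refl)
    ... | yes refl | no _     = subst (_≤ B) (sym (trans (+-identityʳ _) (+-comm (f d) 1))) fd₀<B
    ... | no _     | yes refl = subst (_≤ B) (sym (trans (cong (_+ 1) (+-identityʳ (f d))) (+-comm (f d) 1))) fd₁<B
    ... | no _     | no _     = subst (_≤ B) (sym (trans (+-identityʳ _) (+-identityʳ _))) (f≤B d d<n)

module ResidueClasses (N : ℕ) .{{_ : NonZero N}} where

  open import Data.Nat
  open import Data.Nat.Properties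
  open import Data.Nat.Divisibility as ℕ∣ using (>⇒∤)
  open import Data.Integer as ℤ using (ℤ; +_; -[1+_])
  import Data.Integer.Properties as ℤ
  open import Data.Integer.Divisibility.Signed using (_∣_; _∣?_; ∣⇒∣ᵤ; ∣ᵤ⇒∣; ∣m∣n⇒∣m+n; ∣m+n∣n⇒∣m; ∣-refl)
  open import Data.Integer.Tactic.RingSolver using (solve-∀)
  open import Data.Empty using (⊥-elim)
  open import Data.Product using (Σ; _×_; _,_)
  open import Relation.Binary.PropositionalEquality
  open ≡-Reasoning
  open FiniteSums

  hits : ℤ → ℕ → ℕ
  hits z d = χ ((+ N) ∣? (z ℤ.+ + d))

  hits-wrap : ∀ z → hits z N ≡ hits z 0
  hits-wrap z = χ-cong _ _
    (λ N∣z+N → subst (+ N ∣_) (sym (ℤ.+-identityʳ z)) (∣m+n∣n⇒∣m N∣z+N ∣-refl))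
    (λ N∣z+0 → ∣m∣n⇒∣m+n (subst (+ N ∣_) (ℤ.+-identityʳ z) N∣z+0) ∣-refl)

  hits-suc : ∀ z d → hits (ℤ.suc z) d ≡ hits z (suc d)
  hits-suc z d = cong (λ t → χ ((+ N) ∣? t)) (begin
    (+ 1 ℤ.+ z) ℤ.+ + d ≡⟨ shift z (+ d) ⟩
    z ℤ.+ (+ 1 ℤ.+ + d) ≡⟨ cong (λ t → z ℤ.+ t) (sym (ℤ.pos-+ 1 d)) ⟩
    z ℤ.+ + suc d       ∎)
    where
    shift : ∀ z x → (+ 1 ℤ.+ z) ℤ.+ x ≡ z ℤ.+ (+ 1 ℤ.+ x)
    shift = solve-∀

  Σ-hits-suc : ∀ z → Σ< N (hits (ℤ.suc z)) ≡ Σ< N (hits z)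
  Σ-hits-suc z = +-cancelˡ-≡ (hits z 0) _ _ (begin
    hits z 0 + Σ< N (hits (ℤ.suc z))       ≡⟨ cong (λ t → hits z 0 + t) (Σ<-cong N (λ d _ → hits-suc z d)) ⟩
    hits z 0 + Σ< N (λ d → hits z (suc d)) ≡⟨ Σ<-shift N (hits z) ⟨
    Σ< N (hits z) + hits z N               ≡⟨ cong (λ t → Σ< N (hits z) + t) (hits-wrap z) ⟩
    Σ< N (hits z) + hits z 0               ≡⟨ +-comm (Σ< N (hits z)) (hits z 0) ⟩
    hits z 0 + Σ< N (hits z)               ∎)

  Σ-hits-zero : Σ< N (hits (+ 0)) ≡ 1
  Σ-hits-zero = trans (Σ<-cong N (λ d d<N → χ-cong _ _ (forward d<N) backward)) (Σ<-point N (>-nonZero⁻¹ N))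
    where
    forward : ∀ {d} → d < N → + N ∣ (+ 0 ℤ.+ + d) → d ≡ 0
    forward {zero}  _   _   = refl
    forward {suc d} d<N N∣d = ⊥-elim (>⇒∤ d<N (∣⇒∣ᵤ N∣d))
    backward : ∀ {d} → d ≡ 0 → + N ∣ (+ 0 ℤ.+ + d)
    backward refl = ∣ᵤ⇒∣ (N ℕ∣.∣0)

  exactly-one-residue : ∀ z → Σ< N (hits z) ≡ 1
  exactly-one-residue (+ zero)     = Σ-hits-zero
  exactly-one-residue (+ suc n)    = trans (Σ-hits-suc (+ n)) (exactly-one-residue (+ n))
  exactly-one-residue -[1+ zero ]  = trans (sym (Σ-hits-suc -[1+ 0 ])) Σ-hits-zero
  exactly-one-residue -[1+ suc n ] = trans (sym (Σ-hits-suc -[1+ suc n ])) (exactly-one-residue -[1+ n ])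

  residue : ∀ z → Σ ℕ λ d → d < N × + N ∣ z ℤ.+ + d
  residue z with Σ<≢0⇒ N (hits z) (λ eq → 1+n≢0 (trans (sym (exactly-one-residue z)) eq))
  ... | d , d<N , hit = d , d<N , χ≢0⇒ _ hit

module Valuation (c : ℕ) where

  open import Data.Nat
  open import Data.Nat.Properties
  open import Data.Nat.Divisibility as ℕ∣ using (divides)
  open import Data.Nat.DivMod using (m*n/n≡m)
  open import Data.Integer as ℤ using (ℤ; +_; -[1+_]; ∣_∣)
  import Data.Integer.Properties as ℤ
  open import Data.Integer.Divisibility.Signed using (_∣_; _∣?_; ∣⇒∣ᵤ; ∣ᵤ⇒∣; ∣-trans; divides; ∣m+n∣n⇒∣m; *-cancelʳ-∣; *-monoˡ-∣)
  open import Data.Integer.Tactic.RingSolver using (solve-∀)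
  open import Data.Empty using (⊥-elim)
  open import Function using (_∘_)
  open import Function.Bundles using (_⇔_; mk⇔; Equivalence)
  open import Relation.Nullary using (Dec; yes; no)
  open import Relation.Binary.PropositionalEquality
  open Equivalence using (to; from)
  open import Defs
  open FiniteSums

  b : ℕ
  b = suc (suc c)

  n<b^n : ∀ n → n < b ^ n
  n<b^n zero    = s≤s z≤n
  n<b^n (suc n) = begin-strict
    suc n              ≤⟨ n<b^n n ⟩
    b ^ n              <⟨ m<m+n (b ^ n) (m^n>0 b n) ⟩
    b ^ n + b ^ n      ≤⟨ +-monoʳ-≤ (b ^ n) (m≤m+n (b ^ n) (c * b ^ n)) ⟩
    b * b ^ n          ∎
    where open ≤-Reasoning

  b^m∣b^n : ∀ {m n} → m ≤ n → b ^ m ℕ∣.∣ b ^ n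
  b^m∣b^n {m} {n} m≤n = divides (b ^ (n ∸ m))
    (trans (cong (b ^_) (sym (m+[n∸m]≡n m≤n)))
           (trans (^-distribˡ-+-* b m (n ∸ m)) (*-comm (b ^ m) (b ^ (n ∸ m)))))

  b^suc∣*b⇔ : ∀ m q → b ^ suc m ℕ∣.∣ q * b ⇔ b ^ m ℕ∣.∣ q
  b^suc∣*b⇔ m q = mk⇔
    (λ d → ℕ∣.*-cancelʳ-∣ b (subst (ℕ∣._∣ q * b) (*-comm b (b ^ m)) d))
    (λ d → subst (ℕ∣._∣ q * b) (*-comm (b ^ m) b) (ℕ∣.*-monoˡ-∣ b d))

  valAux-spec : ∀ fuel n → 0 < n → n ≤ fuel → ∀ m → b ^ m ℕ∣.∣ n ⇔ m ≤ valAux b fuel n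
  valAux-spec zero    n 0<n n≤0 m = ⊥-elim (<-irrefl refl (≤-trans 0<n n≤0))
  valAux-spec (suc f) n 0<n n≤1+f m with b ℕ∣.∣? n
  valAux-spec (suc f) n 0<n n≤1+f zero    | _ = mk⇔ (λ _ → z≤n) (λ _ → ℕ∣.1∣ n)
  valAux-spec (suc f) n 0<n n≤1+f (suc m) | no b∤n =
    mk⇔ (λ d → ⊥-elim (b∤n (ℕ∣.∣-trans (ℕ∣.m∣m*n (b ^ m)) d))) (λ ())
  valAux-spec (suc f) n 0<n n≤1+f (suc m) | yes (divides q n≡q*b) =
    mk⇔ (λ d → s≤s (to IH (to (b^suc∣*b⇔ m q) (subst (b ^ suc m ℕ∣.∣_) n≡q*b d))))
        (λ { (s≤s m≤v) → subst (b ^ suc m ℕ∣.∣_) (sym n≡q*b) (from (b^suc∣*b⇔ m q) (from IH m≤v)) })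
    where
    0<q : 0 < q
    0<q = n≢0⇒n>0 (λ q≡0 → <-irrefl (sym (trans n≡q*b (cong (_* b) q≡0))) 0<n)
    q<n : q < n
    q<n = subst (q <_) (sym n≡q*b) (subst (_< q * b) (*-identityʳ q) (*-monoʳ-< q {1} {b} (s≤s (s≤s z≤n))))
      where instance _ = >-nonZero 0<q
    IH : b ^ m ℕ∣.∣ q ⇔ m ≤ valAux b f (n / b)
    IH = subst (λ t → b ^ m ℕ∣.∣ q ⇔ m ≤ valAux b f t) (sym (trans (cong (_/ b) n≡q*b) (m*n/n≡m q b)))
               (valAux-spec f q 0<q (≤-pred (≤-trans q<n n≤1+f)) m)

  val : ℤ → ℕ
  val x = valAux b ∣ x ∣ ∣ x ∣

  ord≡fin-val : ∀ {x} → x ≢ + 0 → ord b x ≡ fin (val x)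
  ord≡fin-val {+ zero}    x≢0 = ⊥-elim (x≢0 refl)
  ord≡fin-val {+ suc _}   _   = refl
  ord≡fin-val { -[1+ _ ]} _   = refl

  infix 4 b^_∣_ b^_∣?_

  b^_∣_ : ℕ → ℤ → Set
  b^ m ∣ x = + (b ^ m) ∣ x

  b^_∣?_ : ∀ m x → Dec (b^ m ∣ x)
  b^ m ∣? x = + (b ^ m) ∣? x

  b^∣⇔≤val : ∀ {x} → x ≢ + 0 → ∀ m → b^ m ∣ x ⇔ m ≤ val x
  b^∣⇔≤val {x} x≢0 m = mk⇔ (λ d → to spec (∣⇒∣ᵤ d)) (λ m≤v → ∣ᵤ⇒∣ (from spec m≤v))
    where
    spec = valAux-spec ∣ x ∣ ∣ x ∣ (n≢0⇒n>0 (x≢0 ∘ ℤ.∣i∣≡0⇒i≡0)) ≤-refl m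

  b^0∣ : ∀ x → b^ 0 ∣ x
  b^0∣ x = ∣ᵤ⇒∣ (ℕ∣.1∣ ∣ x ∣)

  b^∣0 : ∀ m → b^ m ∣ + 0
  b^∣0 m = ∣ᵤ⇒∣ (ℕ∣._∣0 (b ^ m))

  b^∣-anti : ∀ {m m′ x} → m ≤ m′ → b^ m′ ∣ x → b^ m ∣ x
  b^∣-anti m≤m′ = ∣-trans (∣ᵤ⇒∣ (b^m∣b^n m≤m′))

  Σ₁-b^∣≡⊓val : ∀ {x} → x ≢ + 0 → ∀ L → Σ₁ L (λ m → χ (b^ m ∣? x)) ≡ L ⊓ val x
  Σ₁-b^∣≡⊓val x≢0 zero = refl
  Σ₁-b^∣≡⊓val {x} x≢0 (suc L) with b^ suc L ∣? x
  ... | yes d = begin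
    Σ₁ L (λ m → χ (b^ m ∣? x)) + 1  ≡⟨ cong (_+ 1) (Σ₁-b^∣≡⊓val x≢0 L) ⟩
    L ⊓ val x + 1                   ≡⟨ cong (_+ 1) (m≤n⇒m⊓n≡m (≤-trans (n≤1+n L) 1+L≤v)) ⟩
    L + 1                           ≡⟨ +-comm L 1 ⟩
    suc L                           ≡⟨ m≤n⇒m⊓n≡m 1+L≤v ⟨
    suc L ⊓ val x                   ∎
    where
    open ≡-Reasoning
    1+L≤v = to (b^∣⇔≤val x≢0 (suc L)) d
  ... | no ¬d = begin
    Σ₁ L (λ m → χ (b^ m ∣? x)) + 0  ≡⟨ +-identityʳ _ ⟩
    Σ₁ L (λ m → χ (b^ m ∣? x))      ≡⟨ Σ₁-b^∣≡⊓val x≢0 L ⟩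
    L ⊓ val x                       ≡⟨ m≥n⇒m⊓n≡n v≤L ⟩
    val x                           ≡⟨ m≥n⇒m⊓n≡n (≤-trans v≤L (n≤1+n L)) ⟨
    suc L ⊓ val x                   ∎
    where
    open ≡-Reasoning
    v≤L : val x ≤ L
    v≤L = ≮⇒≥ (λ L<v → ¬d (from (b^∣⇔≤val x≢0 (suc L)) L<v))

  χ-b^∣-split : ∀ K y → χ (b^ K ∣? y) ≡ Σ< b (λ e → χ (b^ suc K ∣? y ℤ.+ + (e * b ^ K)))
  χ-b^∣-split K y with b^ K ∣? y
  ... | yes (divides w y≡w*B) = sym (trans (Σ<-cong b (λ e _ → χ-cong _ _ (cancelB e) (scaleB e)))
                                              (ResidueClasses.exactly-one-residue b w))
    where
    B = b ^ K
    instance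
      B≢0 : NonZero B
      B≢0 = m^n≢0 b K
    collect : ∀ w B e → w ℤ.* B ℤ.+ e ℤ.* B ≡ (w ℤ.+ e) ℤ.* B
    collect = solve-∀
    shifted : ∀ e → y ℤ.+ + (e * B) ≡ (w ℤ.+ + e) ℤ.* + B
    shifted e = trans (cong₂ ℤ._+_ y≡w*B (ℤ.pos-* e B)) (collect w (+ B) (+ e))
    b^suc≡b*B : + (b ^ suc K) ≡ + b ℤ.* + B
    b^suc≡b*B = ℤ.pos-* b B
    cancelB : ∀ e → b^ suc K ∣ y ℤ.+ + (e * B) → + b ∣ w ℤ.+ + e
    cancelB e d = *-cancelʳ-∣ (+ B) (subst₂ _∣_ b^suc≡b*B (shifted e) d)
    scaleB : ∀ e → + b ∣ w ℤ.+ + e → b^ suc K ∣ y ℤ.+ + (e * B)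
    scaleB e d = subst₂ _∣_ (sym b^suc≡b*B) (sym (shifted e)) (*-monoˡ-∣ (+ B) d)
  ... | no b^K∤y = sym (trans (Σ<-cong b (λ e _ → χ-no _ (λ d → b^K∤y (∣m+n∣n⇒∣m (b^∣-anti (n≤1+n K) d) (∣ᵤ⇒∣ (ℕ∣.n∣m*n e))))))
                            (Σ<-zero b))

  floorSum : ℕ → ℕ → ℕ
  floorSum L x = Σ₁ L (λ m → (x / b ^ m) {{m^n≢0 b m}})

module ExtendedNaturals where

  open import Data.Nat
  open import Data.Integer using (+_)
  open import Data.Product using (Σ; _×_; _,_)
  open import Relation.Binary.PropositionalEquality
  open import Defs

  ord-zero : ∀ b → ord b (+ 0) ≡ ∞
  ord-zero zero          = refl
  ord-zero (suc zero)    = refl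
  ord-zero (suc (suc _)) = refl

  ∞≢fin : ∀ {X} → ∞ ≢ fin X
  ∞≢fin ()

  fin-injective : ∀ {x y} → fin x ≡ fin y → x ≡ y
  fin-injective refl = refl

  ≤∞fin⇒ : ∀ {x Y} → x ≤∞ fin Y → Σ ℕ λ X → x ≡ fin X × X ≤ Y
  ≤∞fin⇒ (fin≤fin X≤Y) = _ , refl , X≤Y

  +∞-∞ : ∀ x → x +∞ ∞ ≡ ∞
  +∞-∞ (fin _) = refl
  +∞-∞ ∞       = refl

  +∞≡fin⇒ˡ : ∀ x {y X} → x +∞ y ≡ fin X → Σ ℕ λ X′ → x ≡ fin X′
  +∞≡fin⇒ˡ (fin X′) _ = X′ , refl

module OrderingSums (b : ℕ) (s : ℕ → ℤ) where

  open import Data.Nat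
  open import Data.Nat.Properties
  open import Data.Integer as ℤ using (+_)
  open import Data.Product using (_,_)
  open import Relation.Nullary using (yes; no)
  open import Relation.Binary.PropositionalEquality
  open import Defs
  open FiniteSums
  open ExtendedNaturals

  sumOrd≡fin-Σ : ∀ (v : ℤ → ℕ) → (∀ {x} → x ≢ + 0 → ord b x ≡ fin (v x)) →
                 ∀ n y → (∀ j → j < n → y ℤ.- s j ≢ + 0) → sumOrd b s n y ≡ fin (Σ< n (λ j → v (y ℤ.- s j)))
  sumOrd≡fin-Σ v ord≡v zero    y nz = refl
  sumOrd≡fin-Σ v ord≡v (suc n) y nz
    rewrite sumOrd≡fin-Σ v ord≡v n y (λ j j<n → nz j (m<n⇒m<1+n j<n)) | ord≡v (nz n ≤-refl) = refl

  sumOrd≡fin⇒≢0 : ∀ n y {X} → sumOrd b s n y ≡ fin X → ∀ j → j < n → y ℤ.- s j ≢ + 0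
  sumOrd≡fin⇒≢0 (suc n) y eq j j<1+n y-sj≡0 with j ≟ n
  ... | yes refl = ∞≢fin (trans (sym sumOrd≡∞) eq)
    where
    sumOrd≡∞ : sumOrd b s (suc n) y ≡ ∞
    sumOrd≡∞ = begin
      sumOrd b s n y +∞ ord b (y ℤ.- s n)  ≡⟨ cong (λ x → sumOrd b s n y +∞ ord b x) y-sj≡0 ⟩
      sumOrd b s n y +∞ ord b (+ 0)        ≡⟨ cong (sumOrd b s n y +∞_) (ord-zero b) ⟩
      sumOrd b s n y +∞ ∞                  ≡⟨ +∞-∞ (sumOrd b s n y) ⟩
      ∞                                    ∎
      where open ≡-Reasoning
  ... | no j≢n with +∞≡fin⇒ˡ (sumOrd b s n y) eq
  ...   | _ , eq′ = sumOrd≡fin⇒≢0 n y eq′ j (≤∧≢⇒< (≤-pred j<1+n) j≢n) y-sj≡0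

module ResidueCounts (c : ℕ) (s : ℕ → ℤ) where

  open import Data.Nat
  open import Data.Nat.Properties
  open import Data.Integer as ℤ using (ℤ; +_)
  open import Data.Integer.Divisibility.Signed using (∣m∣n⇒∣m-n; ∣m∣n⇒∣m+n)
  open import Data.Integer.Tactic.RingSolver using (solve-∀)
  open import Relation.Nullary using (yes; no)
  open import Relation.Binary.PropositionalEquality
  open ≡-Reasoning
  open FiniteSums
  open Valuation c

  count : ℕ → ℕ → ℤ → ℕ
  count m n a = Σ< n (λ j → χ (b^ m ∣? a ℤ.- s j))

  count-zero : ∀ n a → count 0 n a ≡ n
  count-zero n a = trans (Σ<-cong n (λ j _ → χ-yes _ (b^0∣ _))) (trans (Σ<-const n 1) (*-identityʳ n))

  count-cong : ∀ m n a a′ → b^ m ∣ a ℤ.- a′ → count m n a ≡ count m n a′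
  count-cong m n a a′ d = Σ<-cong n (λ j _ → χ-cong _ _
    (λ da → subst (b^ m ∣_) (diff₁ a a′ (s j)) (∣m∣n⇒∣m-n da d))
    (λ da′ → subst (b^ m ∣_) (diff₂ a a′ (s j)) (∣m∣n⇒∣m+n d da′)))
    where
    diff₁ : ∀ a a′ t → (a ℤ.- t) ℤ.- (a ℤ.- a′) ≡ a′ ℤ.- t
    diff₁ = solve-∀
    diff₂ : ∀ a a′ t → (a ℤ.- a′) ℤ.+ (a′ ℤ.- t) ≡ a ℤ.- t
    diff₂ = solve-∀

  count-anti : ∀ {m m′} n a → m ≤ m′ → count m′ n a ≤ count m n a
  count-anti {m} {m′} n a m≤m′ = Σ<-mono n (λ j _ → anti (b^ m′ ∣? a ℤ.- s j))
    where
    anti : ∀ {x} (d′ : _) → χ d′ ≤ χ (b^ m ∣? x)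
    anti (yes d) = ≤-reflexive (sym (χ-yes _ (b^∣-anti m≤m′ d)))
    anti (no _)  = z≤n

  Σ-count-residues : ∀ m n x → Σ< (b ^ m) (λ d → count m n (x ℤ.+ + d)) ≡ n
  Σ-count-residues m n x = begin
    Σ< (b ^ m) (λ d → Σ< n (λ j → χ (b^ m ∣? (x ℤ.+ + d) ℤ.- s j)))   ≡⟨ Σ<-swap (b ^ m) n _ ⟩
    Σ< n (λ j → Σ< (b ^ m) (λ d → χ (b^ m ∣? (x ℤ.+ + d) ℤ.- s j)))   ≡⟨ Σ<-cong n (λ j _ → one-residue j) ⟩
    Σ< n (λ _ → 1)                                                  ≡⟨ trans (Σ<-const n 1) (*-identityʳ n) ⟩
    n                                                               ∎
    where
    reorder : ∀ x d t → (x ℤ.+ d) ℤ.- t ≡ (x ℤ.- t) ℤ.+ d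
    reorder = solve-∀
    one-residue : ∀ j → Σ< (b ^ m) (λ d → χ (b^ m ∣? (x ℤ.+ + d) ℤ.- s j)) ≡ 1
    one-residue j = trans (Σ<-cong (b ^ m) (λ d _ → cong (λ t → χ (b^ m ∣? t)) (reorder x (+ d) (s j))))
                          (ResidueClasses.exactly-one-residue (b ^ m) {{m^n≢0 b m}} (x ℤ.- s j))

  count-split : ∀ K n a → count K n a ≡ Σ< b (λ e → count (suc K) n (a ℤ.+ + (e * b ^ K)))
  count-split K n a = begin
    Σ< n (λ j → χ (b^ K ∣? a ℤ.- s j))
      ≡⟨ Σ<-cong n (λ j _ → χ-b^∣-split K (a ℤ.- s j)) ⟩
    Σ< n (λ j → Σ< b (λ e → χ (b^ suc K ∣? (a ℤ.- s j) ℤ.+ + (e * b ^ K))))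
      ≡⟨ Σ<-cong n (λ j _ → Σ<-cong b (λ e _ → cong (λ t → χ (b^ suc K ∣? t)) (reorder a (+ (e * b ^ K)) (s j)))) ⟩
    Σ< n (λ j → Σ< b (λ e → χ (b^ suc K ∣? (a ℤ.+ + (e * b ^ K)) ℤ.- s j)))
      ≡⟨ Σ<-swap n b _ ⟩
    Σ< b (λ e → count (suc K) n (a ℤ.+ + (e * b ^ K)))
      ∎
    where
    reorder : ∀ a t u → (a ℤ.- u) ℤ.+ t ≡ (a ℤ.+ t) ℤ.- u
    reorder = solve-∀

module Equidistribution (c : ℕ) (s : ℕ → ℤ) where

  open import Data.Nat
  open import Data.Nat.Properties
  open import Data.Nat.Divisibility using (n∣m*n)
  open import Data.Nat.DivMod using (m*n/n≡m; /-monoˡ-≤; m<n*o⇒m/o<n; m/n*n≤m)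
  open import Data.Integer as ℤ using (ℤ; +_)
  import Data.Integer.Properties as ℤ
  open import Data.Integer.Divisibility.Signed using (∣ᵤ⇒∣)
  open import Data.Integer.Tactic.RingSolver using (solve-∀)
  open import Data.Product using (Σ; _×_; _,_; proj₁; proj₂)
  open import Data.Sum using (inj₁; inj₂)
  open import Data.Empty using (⊥-elim)
  open import Relation.Nullary using (yes; no; ¬_)
  open import Relation.Binary.PropositionalEquality
  open ≤-Reasoning
  open FiniteSums
  open Valuation c
  open ResidueCounts c s

  -- Both bounds together say count m n a ∈ {⌊n / b^m⌋, ⌈n / b^m⌉}.
  Balanced : ℕ → Set
  Balanced n = ∀ m a → n < b ^ m * suc (count m n a) × b ^ m * count m n a < n + b ^ m

  LeastCrowded : ℕ → ℕ → ℤ → Set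
  LeastCrowded m n a = b ^ m * count m n a ≤ n

  balanced-zero : Balanced 0
  balanced-zero m a = subst (0 <_) (sym (*-identityʳ (b ^ m))) (m^n>0 b m)
                    , subst (_< b ^ m) (sym (*-zeroʳ (b ^ m))) (m^n>0 b m)

  floor≤count : ∀ {n} → Balanced n → ∀ m a → (n / b ^ m) {{m^n≢0 b m}} ≤ count m n a
  floor≤count {n} bal m a = ≤-pred (m<n*o⇒m/o<n {{m^n≢0 b m}} (subst (n <_) (*-comm (b ^ m) _) (proj₁ (bal m a))))

  leastCrowded⇒≤floor : ∀ m n a → LeastCrowded m n a → count m n a ≤ (n / b ^ m) {{m^n≢0 b m}}
  leastCrowded⇒≤floor m n a lc = subst (_≤ n / b ^ m) (m*n/n≡m (count m n a) (b ^ m))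
                                             (/-monoˡ-≤ (b ^ m) (subst (_≤ n) (*-comm (b ^ m) _) lc))
    where instance _ = m^n≢0 b m

  ≤floor⇒leastCrowded : ∀ m n a → count m n a ≤ (n / b ^ m) {{m^n≢0 b m}} → LeastCrowded m n a
  ≤floor⇒leastCrowded m n a ≤floor = begin
    b ^ m * count m n a   ≤⟨ *-monoʳ-≤ (b ^ m) ≤floor ⟩
    b ^ m * (n / b ^ m)   ≡⟨ *-comm (b ^ m) _ ⟩
    n / b ^ m * b ^ m     ≤⟨ m/n*n≤m n (b ^ m) ⟩
    n                     ∎
    where instance _ = m^n≢0 b m

  -- The b classes modulo b^(K+1) inside the class of a modulo b^K share its count (count-split),
  -- so by pigeonhole one of them is least crowded as well.
  ∃-leastCrowded : ∀ n K → Σ ℤ λ a → ∀ m → m ≤ K → LeastCrowded m n a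
  ∃-leastCrowded n zero = + 0 , λ { .zero z≤n → ≤-reflexive (trans (*-identityˡ _) (count-zero n (+ 0))) }
  ∃-leastCrowded n (suc K) with ∃-leastCrowded n K
  ... | a , lc with Σ<-pigeonhole b (λ e → b ^ suc K * count (suc K) n (a ℤ.+ + (e * b ^ K))) n
  ...   | inj₁ (e , _ , lc-suc) = a′ , lc′
    where
    a′ = a ℤ.+ + (e * b ^ K)
    cancel : ∀ a t → (a ℤ.+ t) ℤ.- a ≡ t
    cancel = solve-∀
    lc′ : ∀ m → m ≤ suc K → LeastCrowded m n a′
    lc′ m m≤1+K with m ≟ suc K
    ... | yes refl = lc-suc
    ... | no m≢1+K = subst (λ t → b ^ m * t ≤ n) (sym (count-cong m n a′ a same-class)) (lc m m≤K)
      where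
      m≤K = ≤-pred (≤∧≢⇒< m≤1+K m≢1+K)
      same-class : b^ m ∣ a′ ℤ.- a
      same-class = subst (b^ m ∣_) (sym (cancel a _)) (b^∣-anti m≤K (∣ᵤ⇒∣ (n∣m*n e)))
  ...   | inj₂ crowded = ⊥-elim (<-irrefl refl (<-≤-trans (begin-strict
    Σ< b (λ e → b ^ suc K * count (suc K) n (a ℤ.+ + (e * b ^ K)))
      ≡⟨ Σ<-*ˡ b (b ^ suc K) _ ⟩
    b ^ suc K * Σ< b (λ e → count (suc K) n (a ℤ.+ + (e * b ^ K)))
      ≡⟨ cong (b ^ suc K *_) (count-split K n a) ⟨
    b * b ^ K * count K n a
      ≡⟨ *-assoc b (b ^ K) _ ⟩
    b * (b ^ K * count K n a)
      ≤⟨ *-monoʳ-≤ b (lc K ≤-refl) ⟩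
    b * n
      <⟨ *-monoʳ-< b (n<1+n n) ⟩
    b * suc n
      ∎) crowded))

  -- If n + 1 = b^m (count m n a + 1), every class mod b^m holds at most count m n a + 1 of the first n
  -- terms while the distinct classes of a and of s n hold fewer; summing over the classes gives n + 2 ≤ n + 1.
  no-full-class : ∀ {n} → Balanced n → (∀ m → LeastCrowded m n (s n)) →
                  ∀ m a → ¬ b^ m ∣ a ℤ.- s n → suc n ≢ b ^ m * suc (count m n a)
  no-full-class {n} bal lc m a ¬d full = <-irrefl refl (begin
    2 + n                ≡⟨ cong (λ t → 2 + t) (Σ-count-residues m n a) ⟨
    2 + Σ< N f           ≤⟨ Σ<-two-deficits N f (suc cc) (m^n>0 b m) d₁<N (≢-sym d₁≢0) f≤ f0< fd₁< ⟩
    N * suc cc           ≡⟨ full ⟨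
    suc n                ∎)
    where
    N  = b ^ m
    cc = count m n a
    f : ℕ → ℕ
    f d = count m n (a ℤ.+ + d)
    f0≡cc : f 0 ≡ cc
    f0≡cc = cong (count m n) (ℤ.+-identityʳ a)
    f0< : f 0 < suc cc
    f0< = ≤-reflexive (cong suc f0≡cc)
    f≤ : ∀ d → d < N → f d ≤ suc cc
    f≤ d _ = ≤-pred (*-cancelˡ-< N _ _ (begin-strict
      N * f d              <⟨ proj₂ (bal m (a ℤ.+ + d)) ⟩
      n + N                <⟨ n<1+n (n + N) ⟩
      suc n + N            ≡⟨ cong (_+ N) full ⟩
      N * suc cc + N       ≡⟨ +-comm (N * suc cc) N ⟩
      N + N * suc cc       ≡⟨ *-suc N (suc cc) ⟨
      N * suc (suc cc)     ∎))
    residue-of-s = ResidueClasses.residue N {{m^n≢0 b m}} (a ℤ.- s n)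
    d₁ = proj₁ residue-of-s
    d₁<N = proj₁ (proj₂ residue-of-s)
    d₁-hit : b^ m ∣ (a ℤ.- s n) ℤ.+ + d₁
    d₁-hit = proj₂ (proj₂ residue-of-s)
    d₁≢0 : d₁ ≢ 0
    d₁≢0 d₁≡0 = ¬d (subst (b^ m ∣_) (trans (cong (λ t → (a ℤ.- s n) ℤ.+ + t) d₁≡0) (ℤ.+-identityʳ _)) d₁-hit)
    reorder : ∀ a d t → (a ℤ.+ d) ℤ.- t ≡ (a ℤ.- t) ℤ.+ d
    reorder = solve-∀
    fd₁< : f d₁ < suc cc
    fd₁< = *-cancelˡ-< N _ _ (begin-strict
      N * f d₁             ≡⟨ cong (N *_) (count-cong m n (a ℤ.+ + d₁) (s n) (subst (b^ m ∣_) (sym (reorder a (+ d₁) (s n))) d₁-hit)) ⟩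
      N * count m n (s n)  ≤⟨ lc m ⟩
      n                    <⟨ n<1+n n ⟩
      suc n                ≡⟨ full ⟩
      N * suc cc           ∎)

  balanced-suc : ∀ {n} → Balanced n → (∀ m → LeastCrowded m n (s n)) → Balanced (suc n)
  balanced-suc {n} bal lc m a with b^ m ∣? a ℤ.- s n
  ... | yes d rewrite count-cong m n a (s n) d | +-comm (count m n (s n)) 1 = lower , upper
    where
    N  = b ^ m
    c₀ = count m n (s n)
    lower : suc n < N * suc (suc c₀)
    lower = begin-strict
      suc n              ≤⟨ proj₁ (bal m (s n)) ⟩
      N * suc c₀         <⟨ m<n+m (N * suc c₀) (m^n>0 b m) ⟩
      N + N * suc c₀     ≡⟨ *-suc N (suc c₀) ⟨
      N * suc (suc c₀)   ∎
    upper : N * suc c₀ < suc n + N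
    upper = begin-strict
      N * suc c₀         ≡⟨ *-suc N c₀ ⟩
      N + N * c₀         ≤⟨ +-monoʳ-≤ N (lc m) ⟩
      N + n              ≡⟨ +-comm N n ⟩
      n + N              <⟨ n<1+n (n + N) ⟩
      suc n + N          ∎
  ... | no ¬d rewrite +-identityʳ (count m n a) =
    ≤∧≢⇒< (proj₁ (bal m a)) (no-full-class bal lc m a ¬d) , m<n⇒m<1+n (proj₂ (bal m a))

module BOrderingsOfℤ (c : ℕ) (s : ℕ → ℤ) where

  open import Data.Nat
  open import Data.Nat.Properties
  open import Data.Nat.DivMod using (m<n⇒m/n≡0)
  open import Data.Integer as ℤ using (ℤ; +_)
  open import Data.Product using (_×_; _,_; proj₁; proj₂)
  open import Function.Bundles using (Equivalence)
  open import Relation.Nullary using (yes; no; ¬_)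
  open import Relation.Binary.PropositionalEquality
  open Equivalence using (to; from)
  open import Defs
  open FiniteSums
  open ExtendedNaturals
  open Valuation c
  open OrderingSums b s
  open ResidueCounts c s
  open Equidistribution c s

  sumOrd≡fin-Σval : ∀ n y → (∀ j → j < n → y ℤ.- s j ≢ + 0) → sumOrd b s n y ≡ fin (Σ< n (λ j → val (y ℤ.- s j)))
  sumOrd≡fin-Σval = sumOrd≡fin-Σ val ord≡fin-val

  Σ₁-count≡Σ⊓val : ∀ n y → (∀ j → j < n → y ℤ.- s j ≢ + 0) →
                   ∀ L → Σ₁ L (λ m → count m n y) ≡ Σ< n (λ j → L ⊓ val (y ℤ.- s j))
  Σ₁-count≡Σ⊓val n y nz L = trans (Σ<-swap L n _) (Σ<-cong n (λ j j<n → Σ₁-b^∣≡⊓val (nz j j<n) L))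

  floorSum≤Σ₁-count : ∀ {n} → Balanced n → ∀ L y → floorSum L n ≤ Σ₁ L (λ m → count m n y)
  floorSum≤Σ₁-count bal L y = Σ<-mono L (λ m _ → floor≤count bal (suc m) y)

  sumOrd-leastCrowded : ∀ {n} → Balanced n → ∀ a → (∀ m → m ≤ n → LeastCrowded m n a) →
                        sumOrd b s n a ≡ fin (floorSum n n)
  sumOrd-leastCrowded {n} bal a lc = begin
    sumOrd b s n a                               ≡⟨ sumOrd≡fin-Σval n a nz ⟩
    fin (Σ< n (λ j → val (a ℤ.- s j)))           ≡⟨ cong fin (Σ<-cong n (λ j j<n → m≥n⇒m⊓n≡n (val≤n j<n))) ⟨
    fin (Σ< n (λ j → n ⊓ val (a ℤ.- s j)))       ≡⟨ cong fin (Σ₁-count≡Σ⊓val n a nz n) ⟨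
    fin (Σ₁ n (λ m → count m n a))               ≡⟨ cong fin (Σ<-cong n count≡floor) ⟩
    fin (floorSum n n)                           ∎
    where
    open ≡-Reasoning
    count≡floor : ∀ m → m < n → count (suc m) n a ≡ (n / b ^ suc m) {{m^n≢0 b (suc m)}}
    count≡floor m m<n = ≤-antisym (leastCrowded⇒≤floor (suc m) n a (lc (suc m) m<n)) (floor≤count bal (suc m) a)
    count-n≡0 : count n n a ≡ 0
    count-n≡0 = n≤0⇒n≡0 (≤-trans (leastCrowded⇒≤floor n n a (lc n ≤-refl))
                                  (≤-reflexive (m<n⇒m/n≡0 {{m^n≢0 b n}} (n<b^n n))))
    ¬b^n∣ : ∀ {j} → j < n → ¬ b^ n ∣ a ℤ.- s j
    ¬b^n∣ j<n d = 1+n≢0 (trans (sym (χ-yes _ d)) (Σ<≡0⇒ n _ count-n≡0 j<n))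
    nz : ∀ j → j < n → a ℤ.- s j ≢ + 0
    nz j j<n eq = ¬b^n∣ j<n (subst (b^ n ∣_) (sym eq) (b^∣0 n))
    val≤n : ∀ {j} → j < n → val (a ℤ.- s j) ≤ n
    val≤n {j} j<n = ≮⇒≥ (λ n<v → ¬b^n∣ j<n (from (b^∣⇔≤val (nz j j<n) n) (<⇒≤ n<v)))

  module _ (bo : IsBOrdering b s) where

    -- s n does at least as well as a least-crowded a, which attains floorSum n n, while balance already
    -- forces every count at s n up to its floor: so all these inequalities are equalities.
    α≡floorSum-and-counts : ∀ {n} → Balanced n → 1 ≤ n →
      α b s n ≡ fin (floorSum n n) × (∀ i → i < n → count (suc i) n (s n) ≡ (n / b ^ suc i) {{m^n≢0 b (suc i)}})
    α≡floorSum-and-counts {n} bal 1≤n = trans eqX (cong fin X≡floorSum) , counts≡floors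
      where
      a = proj₁ (∃-leastCrowded n n)
      optimal : sumOrd b s n (s n) ≤∞ fin (floorSum n n)
      optimal = subst (sumOrd b s n (s n) ≤∞_) (sumOrd-leastCrowded bal a (proj₂ (∃-leastCrowded n n))) (bo n 1≤n a)
      X   = proj₁ (≤∞fin⇒ optimal)
      eqX = proj₁ (proj₂ (≤∞fin⇒ optimal))
      X≤  = proj₂ (proj₂ (≤∞fin⇒ optimal))
      nz  = sumOrd≡fin⇒≢0 n (s n) eqX
      Σ₁-count≤X : Σ₁ n (λ m → count m n (s n)) ≤ X
      Σ₁-count≤X = begin
        Σ₁ n (λ m → count m n (s n))                ≡⟨ Σ₁-count≡Σ⊓val n (s n) nz n ⟩
        Σ< n (λ j → n ⊓ val (s n ℤ.- s j))          ≤⟨ Σ<-mono n (λ j _ → m⊓n≤n n _) ⟩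
        Σ< n (λ j → val (s n ℤ.- s j))              ≡⟨ fin-injective (trans (sym (sumOrd≡fin-Σval n (s n) nz)) eqX) ⟩
        X                                           ∎
        where open ≤-Reasoning
      X≡floorSum : X ≡ floorSum n n
      X≡floorSum = ≤-antisym X≤ (≤-trans (floorSum≤Σ₁-count bal n (s n)) Σ₁-count≤X)
      counts≡floors : ∀ i → i < n → count (suc i) n (s n) ≡ (n / b ^ suc i) {{m^n≢0 b (suc i)}}
      counts≡floors i i<n = sym (Σ<-mono-≡ n (λ m _ → floor≤count bal (suc m) (s n))
                                  (≤-trans Σ₁-count≤X (≤-reflexive X≡floorSum)) i i<n)

    s-leastCrowded : ∀ {n} → Balanced (suc n) → ∀ m → LeastCrowded m (suc n) (s (suc n))
    s-leastCrowded {n} bal zero = ≤-reflexive (trans (*-identityˡ _) (count-zero (suc n) (s (suc n))))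
    s-leastCrowded {n} bal (suc i) with i <? suc n
    ... | yes i<1+n = ≤floor⇒leastCrowded (suc i) (suc n) (s (suc n))
                        (≤-reflexive (proj₂ (α≡floorSum-and-counts bal (s≤s z≤n)) i i<1+n))
    ... | no i≮1+n  = subst (λ t → b ^ suc i * t ≤ suc n) (sym count≡0) (≤-trans (≤-reflexive (*-zeroʳ (b ^ suc i))) z≤n)
      where
      count-top : count (suc n) (suc n) (s (suc n)) ≡ 0
      count-top = trans (proj₂ (α≡floorSum-and-counts bal (s≤s z≤n)) n ≤-refl)
                        (m<n⇒m/n≡0 {{m^n≢0 b (suc n)}} (n<b^n (suc n)))
      count≡0 : count (suc i) (suc n) (s (suc n)) ≡ 0
      count≡0 = n≤0⇒n≡0 (≤-trans (count-anti (suc n) (s (suc n)) (≤-trans (≮⇒≥ i≮1+n) (n≤1+n i)))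
                                 (≤-reflexive count-top))

    balanced : ∀ n → Balanced n
    balanced zero          = balanced-zero
    balanced (suc zero)    = balanced-suc balanced-zero (λ m → ≤-reflexive (*-zeroʳ (b ^ m)))
    balanced (suc (suc n)) = balanced-suc (balanced (suc n)) (s-leastCrowded (balanced (suc n)))

    α≡floorSum : ∀ n → α b s n ≡ fin (floorSum n n)
    α≡floorSum zero    = refl
    α≡floorSum (suc n) = proj₁ (α≡floorSum-and-counts (balanced (suc n)) (s≤s z≤n))

module Legendre (c : ℕ) where

  open import Data.Nat
  open import Data.Nat.Properties
  open import Data.Nat.DivMod
  open import Data.Nat.Tactic.RingSolver using (solve-∀)
  open import Data.Integer as ℤ using (+_)
  import Data.Integer.Properties as ℤ
  import Data.Integer.Tactic.RingSolver as ℤ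
  open import Relation.Binary.PropositionalEquality
  open import Defs
  open FiniteSums
  open Valuation c using (b; n<b^n; floorSum)

  floorSum-suc : ∀ L n → floorSum (suc L) n ≡ n / b + floorSum L (n / b)
  floorSum-suc L n = trans (Σ<-shift L (λ m → (n / b ^ suc m) {{m^n≢0 b (suc m)}}))
    (cong₂ _+_ (/-congʳ {m = n} {{m^n≢0 b 1}} (*-identityʳ b))
               (Σ<-cong L (λ m _ → sym (m/n/o≡m/[n*o] n b (b ^ suc m) {{_}} {{m^n≢0 b (suc m)}} {{m^n≢0 b (suc (suc m))}}))))

  floorSum-stable : ∀ {n L} → n ≤ L → floorSum L n ≡ floorSum n n
  floorSum-stable {n} {L} n≤L = trans (cong (λ t → floorSum t n) (sym (m+[n∸m]≡n n≤L))) (extend (L ∸ n))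
    where
    extend : ∀ d → floorSum (n + d) n ≡ floorSum n n
    extend zero    = cong (λ t → floorSum t n) (+-identityʳ n)
    extend (suc d) = begin
      floorSum (n + suc d) n       ≡⟨ cong (λ t → floorSum t n) (+-suc n d) ⟩
      floorSum (n + d) n + n / B   ≡⟨ cong₂ _+_ (extend d) (m<n⇒m/n≡0 n<B) ⟩
      floorSum n n + 0             ≡⟨ +-identityʳ _ ⟩
      floorSum n n                 ∎
      where
      open ≡-Reasoning
      B = b ^ suc (n + d)
      instance _ = m^n≢0 b (suc (n + d))
      n<B : n < B
      n<B = <-≤-trans (n<b^n n) (^-monoʳ-≤ b (≤-trans (m≤m+n n d) (n≤1+n _)))

  floorSum-below-base : ∀ {k} → k < b → floorSum k k ≡ 0
  floorSum-below-base {k} k<b =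
    trans (Σ<-cong k (λ m _ → m<n⇒m/n≡0 {{m^n≢0 b (suc m)}} (<-≤-trans k<b (b≤b^1+m m)))) (Σ<-zero k)
    where
    b≤b^1+m : ∀ m → b ≤ b ^ suc m
    b≤b^1+m m = subst (_≤ b ^ suc m) (*-identityʳ b) (^-monoʳ-≤ b {1} {suc m} (s≤s z≤n))

  /-superadditive : ∀ N .{{_ : NonZero N}} x y → x / N + y / N ≤ (x + y) / N
  /-superadditive N x y = subst (_≤ (x + y) / N) (m*n/n≡m (x / N + y / N) N)
    (/-monoˡ-≤ N (subst (_≤ x + y) (sym (*-distribʳ-+ N (x / N) (y / N))) (+-mono-≤ (m/n*n≤m x N) (m/n*n≤m y N))))

  floorSum-superadditive : ∀ L x y → floorSum L x + floorSum L y ≤ floorSum L (x + y)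
  floorSum-superadditive L x y = subst (_≤ floorSum L (x + y)) (Σ<-+ L _ _)
    (Σ<-mono L (λ m _ → /-superadditive (b ^ suc m) {{m^n≢0 b (suc m)}} x y))

  legendre-digitSumAux : ∀ f n → n < b ^ f → suc c * floorSum f n + digitSumAux b f n ≡ n
  legendre-digitSumAux zero    zero    _         = trans (+-identityʳ _) (*-zeroʳ c)
  legendre-digitSumAux zero    (suc n) (s≤s ())
  legendre-digitSumAux (suc f) n       n<b^1+f = begin
    suc c * floorSum (suc f) n + (n % b + digitSumAux b f q)
      ≡⟨ cong (λ t → suc c * t + (n % b + digitSumAux b f q)) (floorSum-suc f n) ⟩
    suc c * (q + floorSum f q) + (n % b + digitSumAux b f q)
      ≡⟨ regroup (suc c) q (floorSum f q) (n % b) (digitSumAux b f q) ⟩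
    (suc c * floorSum f q + digitSumAux b f q) + suc c * q + n % b
      ≡⟨ cong (λ t → t + suc c * q + n % b) (legendre-digitSumAux f q q<b^f) ⟩
    b * q + n % b
      ≡⟨ trans (+-comm (b * q) (n % b)) (cong (λ t → n % b + t) (*-comm b q)) ⟩
    n % b + q * b
      ≡⟨ m≡m%n+[m/n]*n n b ⟨
    n
      ∎
    where
    open ≡-Reasoning
    q = n / b
    q<b^f : q < b ^ f
    q<b^f = m<n*o⇒m/o<n (subst (n <_) (*-comm b (b ^ f)) n<b^1+f)
    regroup : ∀ a q h r d → a * (q + h) + (r + d) ≡ (a * h + d) + a * q + r
    regroup = solve-∀

  legendre-digitSum : ∀ n → suc c * floorSum n n + digitSum b n ≡ n
  legendre-digitSum n = legendre-digitSumAux n n (n<b^n n)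

  legendre-digitSumℤ : ∀ n → + suc c ℤ.* + floorSum n n ≡ + n ℤ.- + digitSum b n
  legendre-digitSumℤ n = begin
    + suc c ℤ.* + floorSum n n                                        ≡⟨ ℤ.pos-* (suc c) (floorSum n n) ⟨
    + (suc c * floorSum n n)                                          ≡⟨ add-sub _ (+ digitSum b n) ⟩
    (+ (suc c * floorSum n n) ℤ.+ + digitSum b n) ℤ.- + digitSum b n  ≡⟨ cong (ℤ._- + digitSum b n) (ℤ.pos-+ _ (digitSum b n)) ⟨
    + (suc c * floorSum n n + digitSum b n) ℤ.- + digitSum b n        ≡⟨ cong (λ t → + t ℤ.- + digitSum b n) (legendre-digitSum n) ⟩
    + n ℤ.- + digitSum b n                                            ∎
    where
    open ≡-Reasoning
    add-sub : ∀ x d → x ≡ (x ℤ.+ d) ℤ.- d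
    add-sub = ℤ.solve-∀

  sumℤ1-linear : ∀ (A B C : ℕ → ℕ) K →
    sumℤ1 (λ i → (+ A i ℤ.- + B i) ℤ.- + C i) K ≡ (+ Σ₁ K A ℤ.- + Σ₁ K B) ℤ.- + Σ₁ K C
  sumℤ1-linear A B C zero    = refl
  sumℤ1-linear A B C (suc K) = begin
    sumℤ1 term K ℤ.+ term (suc K)
      ≡⟨ cong (ℤ._+ term (suc K)) (sumℤ1-linear A B C K) ⟩
    ((+ Σ₁ K A ℤ.- + Σ₁ K B) ℤ.- + Σ₁ K C) ℤ.+ ((+ A (suc K) ℤ.- + B (suc K)) ℤ.- + C (suc K))
      ≡⟨ interchange (+ Σ₁ K A) (+ Σ₁ K B) (+ Σ₁ K C) (+ A (suc K)) (+ B (suc K)) (+ C (suc K)) ⟩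
    ((+ Σ₁ K A ℤ.+ + A (suc K)) ℤ.- (+ Σ₁ K B ℤ.+ + B (suc K))) ℤ.- (+ Σ₁ K C ℤ.+ + C (suc K))
      ≡⟨ cong₂ ℤ._-_ (cong₂ ℤ._-_ (ℤ.pos-+ (Σ₁ K A) _) (ℤ.pos-+ (Σ₁ K B) _)) (ℤ.pos-+ (Σ₁ K C) _) ⟨
    (+ Σ₁ (suc K) A ℤ.- + Σ₁ (suc K) B) ℤ.- + Σ₁ (suc K) C
      ∎
    where
    open ≡-Reasoning
    term = λ i → (+ A i ℤ.- + B i) ℤ.- + C i
    interchange : ∀ x y z u v w → ((x ℤ.- y) ℤ.- z) ℤ.+ ((u ℤ.- v) ℤ.- w) ≡ ((x ℤ.+ u) ℤ.- (y ℤ.+ v)) ℤ.- (z ℤ.+ w)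
    interchange = ℤ.solve-∀

  module _ {k ℓ} (ℓ≤k : ℓ ≤ k) where

    β≡floorSum-differences :
      β k ℓ b ≡ (+ floorSum k k ℤ.- + floorSum ℓ ℓ) ℤ.- + floorSum (k ∸ ℓ) (k ∸ ℓ)
    β≡floorSum-differences = trans
      (sumℤ1-linear (λ i → (k / b ^ i) {{m^n≢0 b i}}) (λ i → (ℓ / b ^ i) {{m^n≢0 b i}})
                    (λ i → ((k ∸ ℓ) / b ^ i) {{m^n≢0 b i}}) k)
      (cong₂ (λ x y → (+ floorSum k k ℤ.- + x) ℤ.- + y) (floorSum-stable ℓ≤k) (floorSum-stable (m∸n≤m k ℓ)))

    excess : ℕ
    excess = floorSum k k ∸ (floorSum ℓ ℓ + floorSum (k ∸ ℓ) (k ∸ ℓ))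

    floorSum-split : floorSum k k ≡ floorSum ℓ ℓ + floorSum (k ∸ ℓ) (k ∸ ℓ) + excess
    floorSum-split = sym (m+[n∸m]≡n (begin
      floorSum ℓ ℓ + floorSum (k ∸ ℓ) (k ∸ ℓ) ≡⟨ cong₂ _+_ (floorSum-stable ℓ≤k) (floorSum-stable (m∸n≤m k ℓ)) ⟨
      floorSum k ℓ + floorSum k (k ∸ ℓ)       ≤⟨ floorSum-superadditive k ℓ (k ∸ ℓ) ⟩
      floorSum k (ℓ + (k ∸ ℓ))                ≡⟨ cong (floorSum k) (m+[n∸m]≡n ℓ≤k) ⟩
      floorSum k k                            ∎))
      where open ≤-Reasoning

    β≡excess : β k ℓ b ≡ + excess
    β≡excess = begin
      β k ℓ b                                       ≡⟨ β≡floorSum-differences ⟩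
      (+ floorSum k k ℤ.- + Hℓ) ℤ.- + Hk-ℓ          ≡⟨ cong (λ t → (+ t ℤ.- + Hℓ) ℤ.- + Hk-ℓ) floorSum-split ⟩
      (+ (Hℓ + Hk-ℓ + excess) ℤ.- + Hℓ) ℤ.- + Hk-ℓ  ≡⟨ cong (λ t → (t ℤ.- + Hℓ) ℤ.- + Hk-ℓ)
                                                             (trans (ℤ.pos-+ (Hℓ + Hk-ℓ) excess) (cong (ℤ._+ + excess) (ℤ.pos-+ Hℓ Hk-ℓ))) ⟩
      ((+ Hℓ ℤ.+ + Hk-ℓ ℤ.+ + excess) ℤ.- + Hℓ) ℤ.- + Hk-ℓ ≡⟨ cancel (+ Hℓ) (+ Hk-ℓ) (+ excess) ⟩
      + excess                                      ∎
      where
      open ≡-Reasoning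
      Hℓ   = floorSum ℓ ℓ
      Hk-ℓ = floorSum (k ∸ ℓ) (k ∸ ℓ)
      cancel : ∀ x y z → ((x ℤ.+ y ℤ.+ z) ℤ.- x) ℤ.- y ≡ z
      cancel = ℤ.solve-∀

    digitSum-β : + suc c ℤ.* β k ℓ b ≡ (+ digitSum b ℓ ℤ.+ + digitSum b (k ∸ ℓ)) ℤ.- + digitSum b k
    digitSum-β = begin
      + suc c ℤ.* β k ℓ b
        ≡⟨ cong (+ suc c ℤ.*_) β≡floorSum-differences ⟩
      + suc c ℤ.* ((+ floorSum k k ℤ.- + floorSum ℓ ℓ) ℤ.- + floorSum (k ∸ ℓ) (k ∸ ℓ))
        ≡⟨ distrib (+ suc c) (+ floorSum k k) (+ floorSum ℓ ℓ) (+ floorSum (k ∸ ℓ) (k ∸ ℓ)) ⟩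
      (+ suc c ℤ.* + floorSum k k ℤ.- + suc c ℤ.* + floorSum ℓ ℓ) ℤ.- + suc c ℤ.* + floorSum (k ∸ ℓ) (k ∸ ℓ)
        ≡⟨ cong₂ ℤ._-_ (cong₂ ℤ._-_ (legendre-digitSumℤ k) (legendre-digitSumℤ ℓ)) (legendre-digitSumℤ (k ∸ ℓ)) ⟩
      ((+ k ℤ.- dk) ℤ.- (+ ℓ ℤ.- dℓ)) ℤ.- (+ (k ∸ ℓ) ℤ.- dk-ℓ)
        ≡⟨ cong (λ t → ((t ℤ.- dk) ℤ.- (+ ℓ ℤ.- dℓ)) ℤ.- (+ (k ∸ ℓ) ℤ.- dk-ℓ))
                (trans (cong +_ (sym (m+[n∸m]≡n ℓ≤k))) (ℤ.pos-+ ℓ (k ∸ ℓ))) ⟩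
      ((+ ℓ ℤ.+ + (k ∸ ℓ) ℤ.- dk) ℤ.- (+ ℓ ℤ.- dℓ)) ℤ.- (+ (k ∸ ℓ) ℤ.- dk-ℓ)
        ≡⟨ collect (+ ℓ) (+ (k ∸ ℓ)) dk dℓ dk-ℓ ⟩
      (dℓ ℤ.+ dk-ℓ) ℤ.- dk
        ∎
      where
      open ≡-Reasoning
      dk   = + digitSum b k
      dℓ   = + digitSum b ℓ
      dk-ℓ = + digitSum b (k ∸ ℓ)
      distrib : ∀ a x y z → a ℤ.* ((x ℤ.- y) ℤ.- z) ≡ (a ℤ.* x ℤ.- a ℤ.* y) ℤ.- a ℤ.* z
      distrib = ℤ.solve-∀
      collect : ∀ L M u v w → ((L ℤ.+ M ℤ.- u) ℤ.- (L ℤ.- v)) ℤ.- (M ℤ.- w) ≡ (v ℤ.+ w) ℤ.- u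
      collect = ℤ.solve-∀

module Products where

  open import Data.Nat
  open import Data.Nat.Properties
  open import Data.Sum using (inj₁; inj₂)
  open import Relation.Binary.PropositionalEquality
  open import Algebra.Properties.CommutativeSemigroup *-commutativeSemigroup using () renaming (interchange to *-interchange)
  open import Defs

  prodBelow-stable : ∀ (f : ℕ → ℕ) B → (∀ b → B ≤ b → f b ≡ 1) → ∀ d → prodBelow f (B + d) ≡ prodBelow f B
  prodBelow-stable f B f≡1 zero    = cong (prodBelow f) (+-identityʳ B)
  prodBelow-stable f B f≡1 (suc d) = trans (cong (prodBelow f) (+-suc B d))
    (trans (cong₂ _*_ (prodBelow-stable f B f≡1 d) (f≡1 (B + d) (m≤m+n B d))) (*-identityʳ _))

  prodBelow-bound-irrelevant : ∀ (f : ℕ → ℕ) B B′ → (∀ b → B ≤ b → f b ≡ 1) → (∀ b → B′ ≤ b → f b ≡ 1) →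
                               prodBelow f B ≡ prodBelow f B′
  prodBelow-bound-irrelevant f B B′ f≡1 f≡1′ = begin
    prodBelow f B         ≡⟨ prodBelow-stable f B f≡1 B′ ⟨
    prodBelow f (B + B′)  ≡⟨ cong (prodBelow f) (+-comm B B′) ⟩
    prodBelow f (B′ + B)  ≡⟨ prodBelow-stable f B′ f≡1′ B ⟩
    prodBelow f B′        ∎
    where open ≡-Reasoning

  prodBelow-cong : ∀ {f g : ℕ → ℕ} B → (∀ b → f b ≡ g b) → prodBelow f B ≡ prodBelow g B
  prodBelow-cong zero    f≡g = refl
  prodBelow-cong (suc B) f≡g = cong₂ _*_ (prodBelow-cong B f≡g) (f≡g B)

  prodBelow-* : ∀ (f g : ℕ → ℕ) B → prodBelow (λ b → f b * g b) B ≡ prodBelow f B * prodBelow g B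
  prodBelow-* f g zero    = refl
  prodBelow-* f g (suc B) = trans (cong (_* (f B * g B)) (prodBelow-* f g B))
                                  (*-interchange (prodBelow f B) (prodBelow g B) (f B) (g B))

  prodBelow≢0 : ∀ (f : ℕ → ℕ) B → (∀ b → f b ≢ 0) → prodBelow f B ≢ 0
  prodBelow≢0 f zero    f≢0 ()
  prodBelow≢0 f (suc B) f≢0 eq with m*n≡0⇒m≡0∨n≡0 (prodBelow f B) eq
  ... | inj₁ p≡0 = prodBelow≢0 f B f≢0 p≡0
  ... | inj₂ fB≡0 = f≢0 B fB≡0

module NaturalRationals where

  open import Data.Nat using (_*_)
  open import Data.Nat.Coprimality using (1-coprimeTo; sym)
  open import Data.Integer as ℤ using (+_)
  import Data.Integer.Properties as ℤ
  open import Data.Rational as ℚ using (ℚ; mkℚ)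
  import Data.Rational.Properties as ℚ
  open import Relation.Binary.PropositionalEquality using (_≡_; trans; cong; cong₂) renaming (sym to ≡-sym)

  ℕ/1-* : ∀ x y → (+ x ℚ./ 1) ℚ.* (+ y ℚ./ 1) ≡ + (x * y) ℚ./ 1
  ℕ/1-* x y = trans (cong₂ ℚ._*_ (normal x) (normal y)) (cong (ℚ._/ 1) (≡-sym (ℤ.pos-* x y)))
    where
    normal : ∀ x → + x ℚ./ 1 ≡ mkℚ (+ x) 0 (sym (1-coprimeTo x))
    normal x = ℚ.↥p/↧p≡p (mkℚ (+ x) 0 (sym (1-coprimeTo x)))

module ZeroOrderings where

  open import Data.Nat
  open import Data.Nat.Properties
  open import Data.Integer as ℤ using (+_; ∣_∣)
  import Data.Integer.Properties as ℤ
  open import Data.Product using (Σ; _,_)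
  open import Data.Empty using (⊥-elim)
  open import Relation.Binary.PropositionalEquality
  open import Defs
  open FiniteSums
  open ExtendedNaturals

  ord₀ : ∀ {x} → x ≢ + 0 → ord 0 x ≡ fin 0
  ord₀ {+ zero}     x≢0 = ⊥-elim (x≢0 refl)
  ord₀ {+ suc _}    _   = refl
  ord₀ {ℤ.-[1+ _ ]} _   = refl

  sumOrd₀-vanishes : ∀ (s : ℕ → ℤ) n → Σ ℤ.ℤ λ a → sumOrd 0 s n a ≡ fin 0
  sumOrd₀-vanishes s n = far , trans (OrderingSums.sumOrd≡fin-Σ 0 s (λ _ → 0) ord₀ n far far≢) (cong fin (Σ<-zero n))
    where
    far : ℤ.ℤ
    far = + suc (Σ< n (λ j → ∣ s j ∣))
    far≢ : ∀ j → j < n → far ℤ.- s j ≢ + 0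
    far≢ j j<n eq = <-irrefl refl (≤-trans (s≤s (Σ<-term n (λ j → ∣ s j ∣) j<n))
                                           (≤-reflexive (cong ∣_∣ (ℤ.i-j≡0⇒i≡j far (s j) eq))))

  α₀≡0 : ∀ s → IsBOrdering 0 s → ∀ k → α 0 s k ≡ fin 0
  α₀≡0 s bo zero    = refl
  α₀≡0 s bo (suc k) with sumOrd₀-vanishes s (suc k)
  ... | a , sumOrd≡0 with ≤∞fin⇒ (subst (α 0 s (suc k) ≤∞_) sumOrd≡0 (bo (suc k) (s≤s z≤n) a))
  ...   | _ , eq , X≤0 = trans eq (cong fin (n≤0⇒n≡0 X≤0))


module GeneralisedBinomials (ords : ℕ → ℕ → ℤ) (bo : ∀ b → IsBOrdering b (ords b)) where

  open import Data.Nat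
  open import Data.Nat.Properties
  open import Data.Integer as ℤ using (+_)
  import Data.Rational as ℚ
  open import Data.Product using (Σ; _,_)
  open import Data.Sum using (inj₁; inj₂)
  open import Relation.Binary.PropositionalEquality
  open import Defs
  open FiniteSums
  open ExtendedNaturals
  open Products
  open NaturalRationals

  factor : ℕ → ℕ → ℕ
  factor k b = pow∞ b (α b (ords b) k)

  factor-0 : ∀ k → factor k 0 ≡ 1
  factor-0 k = cong (pow∞ 0) (ZeroOrderings.α₀≡0 (ords 0) (bo 0) k)

  factor-1 : ∀ k → factor k 1 ≡ 1
  factor-1 k with α 1 (ords 1) k
  ... | fin n = ^-zeroˡ n
  ... | ∞     = refl

  factor-2+ : ∀ c k → factor k (suc (suc c)) ≡ suc (suc c) ^ Valuation.floorSum c k k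
  factor-2+ c k = cong (pow∞ (suc (suc c))) (BOrderingsOfℤ.α≡floorSum c (ords (suc (suc c))) (bo (suc (suc c))) k)

  factor-beyond : ∀ k b → k < b → factor k b ≡ 1
  factor-beyond k (suc zero)    _   = factor-1 k
  factor-beyond k (suc (suc c)) k<b = trans (factor-2+ c k) (cong (suc (suc c) ^_) (Legendre.floorSum-below-base c k<b))

  factor≢0 : ∀ k b → factor k b ≢ 0
  factor≢0 k zero          = subst (_≢ 0) (sym (factor-0 k)) (λ ())
  factor≢0 k (suc zero)    = subst (_≢ 0) (sym (factor-1 k)) (λ ())
  factor≢0 k (suc (suc c)) = subst (_≢ 0) (sym (factor-2+ c k))
                                   (≢-nonZero⁻¹ _ {{m^n≢0 (suc (suc c)) (Valuation.floorSum c k k)}})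

  genFactorial-exists : ∀ k → Σ ℕ (IsGenFactorial ords k)
  genFactorial-exists k = prodBelow (factor k) (suc k) , suc k , factor-beyond k , refl

  genFactorial≡prodBelow : ∀ {k N B} → IsGenFactorial ords k N → k < B → N ≡ prodBelow (factor k) B
  genFactorial≡prodBelow {k} {N} {B} (B′ , beyond , N≡) k<B =
    trans N≡ (prodBelow-bound-irrelevant (factor k) B′ B beyond (λ b B≤b → factor-beyond k b (<-≤-trans k<B B≤b)))

  genFactorial≢0 : ∀ k {N} → IsGenFactorial ords k N → N ≢ 0
  genFactorial≢0 k g = subst (_≢ 0) (sym (genFactorial≡prodBelow {k} g ≤-refl)) (prodBelow≢0 (factor k) (suc k) (factor≢0 k))

  module _ {k ℓ} (ℓ≤k : ℓ ≤ k) where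

    binomialFactor : ℕ → ℕ
    binomialFactor zero          = 1
    binomialFactor (suc zero)    = 1
    binomialFactor (suc (suc c)) = suc (suc c) ^ Legendre.excess c ℓ≤k

    factor-split : ∀ b → factor k b ≡ factor ℓ b * factor (k ∸ ℓ) b * binomialFactor b
    factor-split zero          rewrite factor-0 k | factor-0 ℓ | factor-0 (k ∸ ℓ) = refl
    factor-split (suc zero)    rewrite factor-1 k | factor-1 ℓ | factor-1 (k ∸ ℓ) = refl
    factor-split (suc (suc c)) = begin
      factor k b                                   ≡⟨ factor-2+ c k ⟩
      b ^ floorSum k k                             ≡⟨ cong (b ^_) (Legendre.floorSum-split c ℓ≤k) ⟩
      b ^ (floorSum ℓ ℓ + floorSum (k ∸ ℓ) (k ∸ ℓ) + e)
        ≡⟨ ^-distribˡ-+-* b (floorSum ℓ ℓ + floorSum (k ∸ ℓ) (k ∸ ℓ)) e ⟩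
      b ^ (floorSum ℓ ℓ + floorSum (k ∸ ℓ) (k ∸ ℓ)) * b ^ e
        ≡⟨ cong (_* b ^ e) (^-distribˡ-+-* b (floorSum ℓ ℓ) (floorSum (k ∸ ℓ) (k ∸ ℓ))) ⟩
      b ^ floorSum ℓ ℓ * b ^ floorSum (k ∸ ℓ) (k ∸ ℓ) * b ^ e
        ≡⟨ cong₂ (λ x y → x * y * b ^ e) (factor-2+ c ℓ) (factor-2+ c (k ∸ ℓ)) ⟨
      factor ℓ b * factor (k ∸ ℓ) b * binomialFactor b ∎
      where
      open ≡-Reasoning
      open Valuation c using (floorSum)
      b = suc (suc c)
      e = Legendre.excess c ℓ≤k

    prodℚ2-zpow-β : ∀ j → prodℚ2 (λ b → zpow b (β k ℓ b)) j ≡ + prodBelow binomialFactor (suc j) ℚ./ 1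
    prodℚ2-zpow-β zero          = refl
    prodℚ2-zpow-β (suc zero)    = refl
    prodℚ2-zpow-β (suc (suc j)) =
      trans (cong₂ ℚ._*_ (prodℚ2-zpow-β (suc j)) (cong (zpow (suc (suc j))) (Legendre.β≡excess j ℓ≤k)))
            (ℕ/1-* (prodBelow binomialFactor (suc (suc j))) (binomialFactor (suc (suc j))))

    genFactorial-split : ∀ {Nk Nℓ Nk-ℓ} → IsGenFactorial ords k Nk → IsGenFactorial ords ℓ Nℓ →
                         IsGenFactorial ords (k ∸ ℓ) Nk-ℓ → Nk ≡ Nℓ * Nk-ℓ * prodBelow binomialFactor (suc k)
    genFactorial-split {Nk} {Nℓ} {Nk-ℓ} gk gℓ gk-ℓ = begin
      Nk
        ≡⟨ genFactorial≡prodBelow {k} gk ≤-refl ⟩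
      prodBelow (factor k) (suc k)
        ≡⟨ prodBelow-cong (suc k) factor-split ⟩
      prodBelow (λ b → factor ℓ b * factor (k ∸ ℓ) b * binomialFactor b) (suc k)
        ≡⟨ prodBelow-* (λ b → factor ℓ b * factor (k ∸ ℓ) b) binomialFactor (suc k) ⟩
      prodBelow (λ b → factor ℓ b * factor (k ∸ ℓ) b) (suc k) * E
        ≡⟨ cong (_* E) (prodBelow-* (factor ℓ) (factor (k ∸ ℓ)) (suc k)) ⟩
      prodBelow (factor ℓ) (suc k) * prodBelow (factor (k ∸ ℓ)) (suc k) * E
        ≡⟨ cong₂ (λ x y → x * y * E) (genFactorial≡prodBelow {ℓ} gℓ (s≤s ℓ≤k))
                                     (genFactorial≡prodBelow {k ∸ ℓ} gk-ℓ (s≤s (m∸n≤m k ℓ))) ⟨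
      Nℓ * Nk-ℓ * E
        ∎
      where
      open ≡-Reasoning
      E = prodBelow binomialFactor (suc k)

    binomial≡∏β : ∀ {Nk Nℓ Nk-ℓ} → IsGenFactorial ords k Nk → IsGenFactorial ords ℓ Nℓ →
                  IsGenFactorial ords (k ∸ ℓ) Nk-ℓ →
                  + Nk ℚ./ 1 ≡ (+ (Nℓ * Nk-ℓ) ℚ./ 1) ℚ.* prodℚ2 (λ b → zpow b (β k ℓ b)) k
    binomial≡∏β {Nk} {Nℓ} {Nk-ℓ} gk gℓ gk-ℓ = sym (begin
      (+ (Nℓ * Nk-ℓ) ℚ./ 1) ℚ.* prodℚ2 (λ b → zpow b (β k ℓ b)) k
        ≡⟨ cong ((+ (Nℓ * Nk-ℓ) ℚ./ 1) ℚ.*_) (prodℚ2-zpow-β k) ⟩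
      (+ (Nℓ * Nk-ℓ) ℚ./ 1) ℚ.* (+ prodBelow binomialFactor (suc k) ℚ./ 1)
        ≡⟨ ℕ/1-* (Nℓ * Nk-ℓ) _ ⟩
      + (Nℓ * Nk-ℓ * prodBelow binomialFactor (suc k)) ℚ./ 1
        ≡⟨ cong (λ t → + t ℚ./ 1) (genFactorial-split gk gℓ gk-ℓ) ⟨
      + Nk ℚ./ 1
        ∎)
      where open ≡-Reasoning

  genFactorial-product≢0 : ∀ k m {Nk Nm} → IsGenFactorial ords k Nk → IsGenFactorial ords m Nm → Nk * Nm ≢ 0
  genFactorial-product≢0 k m gk gm eq with m*n≡0⇒m≡0∨n≡0 _ eq
  ... | inj₁ Nk≡0 = genFactorial≢0 k gk Nk≡0
  ... | inj₂ Nm≡0 = genFactorial≢0 m gm Nm≡0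

open import Data.Nat using (ℕ; _≤_; _∸_; _*_; zero; suc; s≤s)
open import Data.Integer using (+_; _+_; _-_) renaming (_*_ to _*ℤ_)
open import Data.Rational using (_/_) renaming (_*_ to _*ℚ_)
open import Data.Product using (Σ; _×_; _,_)
open import Relation.Binary.PropositionalEquality using (_≡_; _≢_)

digitSum-β : ∀ {k ℓ} → ℓ ≤ k → ∀ b → 2 ≤ b →
             (+ (b ∸ 1)) *ℤ β k ℓ b ≡ ((+ digitSum b ℓ) + (+ digitSum b (k ∸ ℓ))) - (+ digitSum b k)
digitSum-β ℓ≤k (suc (suc c)) _         = Legendre.digitSum-β c ℓ≤k
digitSum-β ℓ≤k (suc zero)    (s≤s ())

theorem7p4 : (ords : ℕ → ℕ → Data.Integer.ℤ) → (∀ b → IsBOrdering b (ords b)) →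
    ∀ k ℓ → ℓ ≤ k →
      -- the generalized factorials k!, ℓ!, (k-ℓ)! (over S = ℤ, T = ℕ) exist
      ((Σ ℕ λ N → IsGenFactorial ords k N)
        × (Σ ℕ λ N → IsGenFactorial ords ℓ N)
        × (Σ ℕ λ N → IsGenFactorial ords (k ∸ ℓ) N))
      -- (1): the binomial k!/(ℓ!(k-ℓ)!) is well defined and equals ∏_{b=2}^k b^β
      × (∀ Nk Nℓ Nkℓ → IsGenFactorial ords k Nk → IsGenFactorial ords ℓ Nℓ
           → IsGenFactorial ords (k ∸ ℓ) Nkℓ
           → (Nℓ * Nkℓ ≢ 0)
             × ((+ Nk) / 1 ≡ ((+ (Nℓ * Nkℓ)) / 1) *ℚ prodℚ2 (λ b → zpow b (β k ℓ b)) k))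
      -- (2): (b-1) β(k,ℓ,b) = d_b(ℓ) + d_b(k-ℓ) - d_b(k) for b ≥ 2
      × (∀ b → 2 ≤ b →
           (+ (b ∸ 1)) *ℤ β k ℓ b ≡ ((+ digitSum b ℓ) + (+ digitSum b (k ∸ ℓ))) - (+ digitSum b k))
theorem7p4 ords bo k ℓ ℓ≤k =
  (genFactorial-exists k , genFactorial-exists ℓ , genFactorial-exists (k ∸ ℓ)) ,
  (λ Nk Nℓ Nkℓ gk gℓ gkℓ → genFactorial-product≢0 ℓ (k ∸ ℓ) gℓ gkℓ , binomial≡∏β ℓ≤k gk gℓ gkℓ) ,
  digitSum-β ℓ≤k
  where open GeneralisedBinomials ords bo
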